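{- Let $q$ be a positive integer, let $\mathcal{S}\subseteq\mathbb{Z}_q=\{0,1,\ldots,q-1\}$ be of size $T$, and let $(u_n)$ be its characteristic sequence: $u_n=1$ if $n\in\mathcal{S}$ and $u_n=0$ otherwise, $n=0,1,\ldots,q-1$. Let $(b_0,\ldots,b_{\ell-1})\in\{0,1\}^\ell$ be a pattern of length $\ell\ge1$, and let $N^{(b_0,\ldots,b_{\ell-1})}(u_n)$ be the number of $n\in\{0,1,\ldots,q-\ell\}$ with $u_{n+i}=b_i$ for $i=0,\ldots,\ell-1$. Then $$N^{(b_0,\ldots,b_{\ell-1})}(u_n)=\left(\frac{T}{q}\right)^{b_0+\cdots+b_{\ell-1}}\left(1-\frac{T}{q}\right)^{\ell-b_0-\cdots-b_{\ell-1}}q+O\left(2^\ell C(\mathcal{S},q,\ell)\right),$$ and the sequence of patterns of length $\ell$ is (asymptotically) balanced, i.e. each pattern in $\{0,1\}^\ell$ occurs $(2^{ -\ell}+o(1))q$ times, if $$T=\frac q2+o(q)\quad\text{and}\quad C(\mathcal{S},q,\ell)=o(q).$$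
   Context: For $\mathcal{R}\subseteq\mathbb{Z}_q$ define $f_{\mathcal{R}}(n)=1-\frac{|\mathcal{R}|}{q}$ if $n\in\mathcal{R}$ and $f_{\mathcal{R}}(n)=-\frac{|\mathcal{R}|}{q}$ otherwise (arguments modulo $q$). The correlation measure of order $k$ is $C_k(\mathcal{R},q)=\max_{1\le M\le q,\ 0\le d_1<\cdots<d_k\le q-1}\left|\sum_{n=0}^{M-1}f_{\mathcal{R}}(n+d_1)\cdots f_{\mathcal{R}}(n+d_k)\right|$, and $C(\mathcal{R},q,s)=\max_{1\le k\le s}C_k(\mathcal{R},q)$. $f=O(g)$ means $|f|\le cg$ with an absolute constant $c>0$; $o(\cdot)$ refers to $q\to\infty$. -}

module Defs where

open import Data.Bool using (Bool; true; false; if_then_else_; _∧_)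
open import Data.Nat using (ℕ; zero; suc; _≤ᵇ_; NonZero)
import Data.Nat as ℕ
open import Data.Nat.DivMod using (_mod_)
open import Data.Fin.Subset using (Subset)
import Data.Fin.Subset as Sub
open import Data.Vec using (Vec; []; _∷_; lookup)
open import Data.List using (List; []; _∷_; map; foldr; upTo; filterᵇ; length; concatMap; _++_)
open import Data.Integer using (+_)
open import Data.Rational using (ℚ; 0ℚ; 1ℚ; _+_; _-_; _*_; _/_; _⊔_; ∣_∣)

powℚ : ℚ → ℕ → ℚ
powℚ x zero = 1ℚ
powℚ x (suc n) = x * powℚ x n

ℕtoℚ : ℕ → ℚ
ℕtoℚ n = (+ n) / 1

-- finite sums, products, maxima (max of an empty list is 0; all maxima
-- below are over absolute values, so this base value is harmless)
sumℚ : List ℚ → ℚ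
sumℚ = foldr _+_ 0ℚ

prodℚ : List ℚ → ℚ
prodℚ = foldr _*_ 1ℚ

maxℚ : List ℚ → ℚ
maxℚ = foldr _⊔_ 0ℚ

card : ∀ {q} → Subset q → ℕ
card S = Sub.∣ S ∣

u : (q : ℕ) .{{_ : NonZero q}} → Subset q → ℕ → Bool
u q S n = lookup S (n mod q)

fR : (q : ℕ) .{{_ : NonZero q}} → Subset q → ℕ → ℚ
fR q S n = (if u q S n then 1ℚ else 0ℚ) - ((+ card S) / q)

choose : ℕ → List ℕ → List (List ℕ)
choose zero xs = [] ∷ []
choose (suc k) [] = []
choose (suc k) (x ∷ xs) = map (x ∷_) (choose k xs) ++ choose (suc k) xs

corrSum : (q : ℕ) .{{_ : NonZero q}} → Subset q → ℕ → List ℕ → ℚ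
corrSum q S M ds = ∣ sumℚ (map (λ n → prodℚ (map (λ d → fR q S (n ℕ.+ d)) ds)) (upTo M)) ∣

-- C_k(S,q): max over 1 ≤ M ≤ q and 0 ≤ d_1 < ... < d_k ≤ q-1
Ck : (q : ℕ) .{{_ : NonZero q}} → Subset q → ℕ → ℚ
Ck q S k = maxℚ (concatMap (λ m → map (corrSum q S (suc m)) (choose k (upTo q))) (upTo q))

Cmeas : (q : ℕ) .{{_ : NonZero q}} → Subset q → ℕ → ℚ
Cmeas q S s = maxℚ (map (λ j → Ck q S (suc j)) (upTo s))

eqB : Bool → Bool → Bool
eqB true true = true
eqB false false = true
eqB _ _ = false

matchAt : ∀ {ℓ} (q : ℕ) .{{_ : NonZero q}} → Subset q → Vec Bool ℓ → ℕ → Bool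
matchAt q S [] n = true
matchAt q S (x ∷ xs) n = eqB x (u q S n) ∧ matchAt q S xs (suc n)

Npat : ∀ {ℓ} (q : ℕ) .{{_ : NonZero q}} → Subset q → Vec Bool ℓ → ℕ
Npat {ℓ} q S b = length (filterᵇ (λ n → (n ℕ.+ ℓ ≤ᵇ q) ∧ matchAt q S b n) (upTo q))

weight : ∀ {ℓ} → Vec Bool ℓ → ℕ
weight [] = 0
weight (true ∷ xs) = suc (weight xs)
weight (false ∷ xs) = weight xs

mainTerm : ∀ {ℓ} (q : ℕ) .{{_ : NonZero q}} → Subset q → Vec Bool ℓ → ℚ
mainTerm {ℓ} q S b =
  powℚ ((+ card S) / q) (weight b) * powℚ (1ℚ - (+ card S) / q) (ℓ ℕ.∸ weight b) * ℕtoℚ q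

-- With α = T/q and f = f_S, the indicator of u_n = b is c_b + s_b f(n), where
-- c_1 = α, c_0 = 1 - α and s_b = ±1.  The indicator of the pattern b at n is the
-- product of these over its ℓ letters; expanding it, the empty index set gives
-- α^w (1-α)^(ℓ-w) per window and each of the other 2^ℓ - 1 terms is a correlation
-- sum of order ≤ ℓ, bounded by C(S,q,ℓ).  There are q - ℓ + 1 windows rather than q,
-- which costs at most ℓ ≤ 2^ℓ ≤ 2^(ℓ+1) C because C ≥ max(α, 1-α) ≥ 1/2.  For the
-- balance statement, divide by q and telescope |∏ c_{b_i} - 2^(-ℓ)| ≤ ℓ |α - 1/2|.
module Submission where

open import Defs
open import Data.Bool using (Bool; true; false; if_then_else_; _∧_; T)
open import Data.Empty using (⊥; ⊥-elim)
open import Data.Unit using (tt)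
open import Data.Nat using (ℕ; zero; suc; NonZero; z≤n; s≤s; _≥_)
import Data.Nat as ℕ
import Data.Nat.Properties as ℕₚ
open import Data.Nat.DivMod using (m<n⇒m%n≡m)
open import Data.Integer as ℤ using (+_)
open import Data.Integer.Tactic.RingSolver using (solve-∀)
open import Data.Fin using (Fin; toℕ; zero; suc)
open import Data.Fin.Properties using (toℕ<n; toℕ-injective; toℕ-fromℕ<)
open import Data.Fin.Subset using (Subset)
open import Data.Fin.Subset.Properties using (∣p∣≤n)
open import Data.Vec using (Vec; []; _∷_; lookup)
open import Data.List using (List; []; _∷_; map; upTo; applyUpTo; _++_; [_]; length; concatMap; filterᵇ)
open import Data.List.Properties using (map-++; upTo-∷ʳ; ++-assoc; ++-identityʳ)
open import Data.List.Membership.Propositional using (_∈_; lose)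
open import Data.List.Membership.Propositional.Properties using (∈-map⁺; ∈-++⁺ˡ; ∈-++⁺ʳ; ∈-upTo⁺; ∈-concatMap⁺)
open import Data.List.Relation.Unary.Any using (here; there)
open import Data.List.Relation.Binary.Sublist.Propositional using (_⊆_; []; _∷_; _∷ʳ_; minimum; from∈; ⊆-trans)
open import Data.List.Relation.Binary.Sublist.Propositional.Properties using (length-mono-≤)
open import Data.Rational using (ℚ; 0ℚ; 1ℚ; ½; _+_; _-_; _*_; _/_; -_; _≤_; _<_; ∣_∣; _⊓_; toℚᵘ; nonNegative; positive)
open import Data.Rational.Properties
import Data.Integer.Properties as ℤₚ
import Data.Rational.Unnormalised as ℚᵘ
import Data.Rational.Unnormalised.Properties as ℚᵘₚ
open import Data.Rational.Solver using (module +-*-Solver)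
open +-*-Solver using (solve; _:+_; _:*_; _:-_; :-_; _:=_; con)
open import Data.Product using (_×_; Σ; _,_)
open import Data.Sum using (inj₁; inj₂)
open import Relation.Binary.PropositionalEquality hiding ([_])
open import Relation.Nullary using (yes; no)
open import Relation.Nullary.Decidable using (toWitness)

ℓ≤2^ℓ : ∀ ℓ → ℓ ℕ.≤ 2 ℕ.^ ℓ
ℓ≤2^ℓ zero = z≤n
ℓ≤2^ℓ (suc ℓ) = ℕₚ.+-mono-≤ (ℕₚ.m^n>0 2 ℓ) (ℕₚ.≤-trans (ℓ≤2^ℓ ℓ) (ℕₚ.m≤m+n (2 ℕ.^ ℓ) 0))

window-fits : ∀ {q ℓ n} → ℓ ℕ.≤ q → n ℕ.< suc (q ℕ.∸ ℓ) → n ℕ.+ ℓ ℕ.≤ q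
window-fits {ℓ = ℓ} ℓ≤q (s≤s n≤q∸ℓ) = ℕₚ.≤-trans (ℕₚ.+-monoˡ-≤ ℓ n≤q∸ℓ) (ℕₚ.≤-reflexive (ℕₚ.m∸n+n≡m ℓ≤q))

window-overflows : ∀ {q ℓ n} → ℓ ℕ.≤ q → suc (q ℕ.∸ ℓ) ℕ.≤ n → n ℕ.+ ℓ ℕ.≤ q → ⊥
window-overflows {q} {ℓ} ℓ≤q q∸ℓ<n n+ℓ≤q = ℕₚ.n≮n q (begin-strict
  q                    ≡⟨ ℕₚ.m∸n+n≡m ℓ≤q ⟨
  q ℕ.∸ ℓ ℕ.+ ℓ        <⟨ ℕₚ.+-monoˡ-< ℓ q∸ℓ<n ⟩
  _                    ≤⟨ n+ℓ≤q ⟩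
  q                    ∎)
  where open ℕₚ.≤-Reasoning

windows+rest : ∀ {q ℓ} → 1 ℕ.≤ ℓ → ℓ ℕ.≤ q → suc (q ℕ.∸ ℓ) ℕ.+ (ℓ ℕ.∸ 1) ≡ q
windows+rest {q} {suc ℓ} _ ℓ≤q = trans (sym (ℕₚ.+-suc (q ℕ.∸ suc ℓ) ℓ)) (ℕₚ.m∸n+n≡m ℓ≤q)

toℚᵘ-ℕtoℚ : ∀ n → toℚᵘ (ℕtoℚ n) ℚᵘ.≃ ℚᵘ.mkℚᵘ (+ n) 0
toℚᵘ-ℕtoℚ n = toℚᵘ-fromℚᵘ (ℚᵘ.mkℚᵘ (+ n) 0)

ℕtoℚ-+ : ∀ m n → ℕtoℚ (m ℕ.+ n) ≡ ℕtoℚ m + ℕtoℚ n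
ℕtoℚ-+ m n = toℚᵘ-injective (begin
  toℚᵘ (ℕtoℚ (m ℕ.+ n))                 ≈⟨ toℚᵘ-ℕtoℚ (m ℕ.+ n) ⟩
  ℚᵘ.mkℚᵘ (+ m ℤ.+ + n) 0               ≈⟨ ℚᵘ.*≡* (ring (+ m) (+ n)) ⟩
  ℚᵘ.mkℚᵘ (+ m) 0 ℚᵘ.+ ℚᵘ.mkℚᵘ (+ n) 0  ≈⟨ ℚᵘₚ.+-cong (ℚᵘₚ.≃-sym (toℚᵘ-ℕtoℚ m)) (ℚᵘₚ.≃-sym (toℚᵘ-ℕtoℚ n)) ⟩
  toℚᵘ (ℕtoℚ m) ℚᵘ.+ toℚᵘ (ℕtoℚ n)      ≈⟨ ℚᵘₚ.≃-sym (toℚᵘ-homo-+ (ℕtoℚ m) (ℕtoℚ n)) ⟩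
  toℚᵘ (ℕtoℚ m + ℕtoℚ n)                ∎)
  where
  open ℚᵘₚ.≃-Reasoning
  ring : ∀ a b → (a ℤ.+ b) ℤ.* (ℤ.1ℤ ℤ.* ℤ.1ℤ) ≡ (a ℤ.* ℤ.1ℤ ℤ.+ b ℤ.* ℤ.1ℤ) ℤ.* ℤ.1ℤ
  ring = solve-∀

ℕtoℚ-* : ∀ m n → ℕtoℚ (m ℕ.* n) ≡ ℕtoℚ m * ℕtoℚ n
ℕtoℚ-* m n = toℚᵘ-injective (begin
  toℚᵘ (ℕtoℚ (m ℕ.* n))                 ≈⟨ toℚᵘ-ℕtoℚ (m ℕ.* n) ⟩
  ℚᵘ.mkℚᵘ (+ (m ℕ.* n)) 0              ≈⟨ ℚᵘ.*≡* (trans (cong (ℤ._* (ℤ.1ℤ ℤ.* ℤ.1ℤ)) (ℤₚ.pos-* m n)) (ring (+ m) (+ n))) ⟩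
  ℚᵘ.mkℚᵘ (+ m) 0 ℚᵘ.* ℚᵘ.mkℚᵘ (+ n) 0  ≈⟨ ℚᵘₚ.*-cong (ℚᵘₚ.≃-sym (toℚᵘ-ℕtoℚ m)) (ℚᵘₚ.≃-sym (toℚᵘ-ℕtoℚ n)) ⟩
  toℚᵘ (ℕtoℚ m) ℚᵘ.* toℚᵘ (ℕtoℚ n)      ≈⟨ ℚᵘₚ.≃-sym (toℚᵘ-homo-* (ℕtoℚ m) (ℕtoℚ n)) ⟩
  toℚᵘ (ℕtoℚ m * ℕtoℚ n)                ∎)
  where
  open ℚᵘₚ.≃-Reasoning
  ring : ∀ a b → (a ℤ.* b) ℤ.* (ℤ.1ℤ ℤ.* ℤ.1ℤ) ≡ (a ℤ.* b) ℤ.* ℤ.1ℤ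
  ring = solve-∀

ℕtoℚ-suc : ∀ n → ℕtoℚ (suc n) ≡ 1ℚ + ℕtoℚ n
ℕtoℚ-suc = ℕtoℚ-+ 1

0≤ℕtoℚ : ∀ n → 0ℚ ≤ ℕtoℚ n
0≤ℕtoℚ n = nonNegative⁻¹ _ {{normalize-nonNeg n 1}}

ℕtoℚ-mono-≤ : ∀ {m n} → m ℕ.≤ n → ℕtoℚ m ≤ ℕtoℚ n
ℕtoℚ-mono-≤ {m} {n} m≤n = begin
  ℕtoℚ m                    ≡⟨ +-identityʳ (ℕtoℚ m) ⟨
  ℕtoℚ m + 0ℚ               ≤⟨ +-monoʳ-≤ (ℕtoℚ m) (0≤ℕtoℚ (n ℕ.∸ m)) ⟩
  ℕtoℚ m + ℕtoℚ (n ℕ.∸ m)   ≡⟨ ℕtoℚ-+ m (n ℕ.∸ m) ⟨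
  ℕtoℚ (m ℕ.+ (n ℕ.∸ m))    ≡⟨ cong ℕtoℚ (ℕₚ.m+[n∸m]≡n m≤n) ⟩
  ℕtoℚ n                    ∎
  where open ≤-Reasoning

ℕtoℚ-2^-suc : ∀ ℓ → ℕtoℚ (2 ℕ.^ suc ℓ) ≡ ℕtoℚ (2 ℕ.^ ℓ) + ℕtoℚ (2 ℕ.^ ℓ)
ℕtoℚ-2^-suc ℓ = trans (ℕtoℚ-+ (2 ℕ.^ ℓ) (2 ℕ.^ ℓ ℕ.+ 0))
  (cong (λ k → ℕtoℚ (2 ℕ.^ ℓ) + ℕtoℚ k) (ℕₚ.+-identityʳ (2 ℕ.^ ℓ)))

2^ℓ*B-suc : ∀ ℓ B → ℕtoℚ (2 ℕ.^ ℓ) * B + ℕtoℚ (2 ℕ.^ ℓ) * B ≡ ℕtoℚ (2 ℕ.^ suc ℓ) * B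
2^ℓ*B-suc ℓ B = trans (sym (*-distribʳ-+ B (ℕtoℚ (2 ℕ.^ ℓ)) (ℕtoℚ (2 ℕ.^ ℓ)))) (cong (_* B) (sym (ℕtoℚ-2^-suc ℓ)))

n/k≡n*[1/k] : ∀ n k .{{_ : NonZero k}} → (+ n) / k ≡ ℕtoℚ n * ((+ 1) / k)
n/k≡n*[1/k] n (suc k) = toℚᵘ-injective (begin
  toℚᵘ ((+ n) / suc k)                       ≈⟨ toℚᵘ-fromℚᵘ (ℚᵘ.mkℚᵘ (+ n) k) ⟩
  ℚᵘ.mkℚᵘ (+ n) k                            ≈⟨ ℚᵘ.*≡* (ring (+ n) (+ suc k)) ⟩
  ℚᵘ.mkℚᵘ (+ n) 0 ℚᵘ.* ℚᵘ.mkℚᵘ (+ 1) k       ≈⟨ ℚᵘₚ.*-cong (ℚᵘₚ.≃-sym (toℚᵘ-ℕtoℚ n)) (ℚᵘₚ.≃-sym (toℚᵘ-fromℚᵘ (ℚᵘ.mkℚᵘ (+ 1) k))) ⟩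
  toℚᵘ (ℕtoℚ n) ℚᵘ.* toℚᵘ ((+ 1) / suc k)    ≈⟨ ℚᵘₚ.≃-sym (toℚᵘ-homo-* (ℕtoℚ n) ((+ 1) / suc k)) ⟩
  toℚᵘ (ℕtoℚ n * ((+ 1) / suc k))            ∎)
  where
  open ℚᵘₚ.≃-Reasoning
  ring : ∀ a d → a ℤ.* (ℤ.1ℤ ℤ.* d) ≡ (a ℤ.* ℤ.1ℤ) ℤ.* d
  ring = solve-∀

k*[1/k]≡1 : ∀ k .{{_ : NonZero k}} → ℕtoℚ k * ((+ 1) / k) ≡ 1ℚ
k*[1/k]≡1 (suc k) = toℚᵘ-injective (begin
  toℚᵘ (ℕtoℚ (suc k) * ((+ 1) / suc k))          ≈⟨ toℚᵘ-homo-* (ℕtoℚ (suc k)) ((+ 1) / suc k) ⟩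
  toℚᵘ (ℕtoℚ (suc k)) ℚᵘ.* toℚᵘ ((+ 1) / suc k)  ≈⟨ ℚᵘₚ.*-cong (toℚᵘ-ℕtoℚ (suc k)) (toℚᵘ-fromℚᵘ (ℚᵘ.mkℚᵘ (+ 1) k)) ⟩
  ℚᵘ.mkℚᵘ (+ suc k) 0 ℚᵘ.* ℚᵘ.mkℚᵘ (+ 1) k       ≈⟨ ℚᵘ.*≡* (ring (+ suc k)) ⟩
  toℚᵘ 1ℚ                                        ∎)
  where
  open ℚᵘₚ.≃-Reasoning
  ring : ∀ d → (d ℤ.* ℤ.1ℤ) ℤ.* ℤ.1ℤ ≡ ℤ.1ℤ ℤ.* (ℤ.1ℤ ℤ.* d)
  ring = solve-∀

sumMap : {A : Set} → List A → (A → ℚ) → ℚ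
sumMap xs h = sumℚ (map h xs)

sumℚ-++ : ∀ xs ys → sumℚ (xs ++ ys) ≡ sumℚ xs + sumℚ ys
sumℚ-++ [] ys = sym (+-identityˡ _)
sumℚ-++ (x ∷ xs) ys = trans (cong (λ z → x + z) (sumℚ-++ xs ys)) (sym (+-assoc x _ _))

prodℚ-++ : ∀ xs ys → prodℚ (xs ++ ys) ≡ prodℚ xs * prodℚ ys
prodℚ-++ [] ys = sym (*-identityˡ _)
prodℚ-++ (x ∷ xs) ys = trans (cong (x *_) (prodℚ-++ xs ys)) (sym (*-assoc x _ _))

sumMap-upTo-suc : ∀ n h → sumMap (upTo (suc n)) h ≡ sumMap (upTo n) h + h n
sumMap-upTo-suc n h = begin
  sumℚ (map h (upTo (suc n)))         ≡⟨ cong (λ xs → sumℚ (map h xs)) (upTo-∷ʳ n) ⟨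
  sumℚ (map h (upTo n ++ [ n ]))      ≡⟨ cong sumℚ (map-++ h (upTo n) [ n ]) ⟩
  sumℚ (map h (upTo n) ++ [ h n ])    ≡⟨ sumℚ-++ (map h (upTo n)) [ h n ] ⟩
  sumMap (upTo n) h + (h n + 0ℚ)      ≡⟨ cong (λ z → sumMap (upTo n) h + z) (+-identityʳ (h n)) ⟩
  sumMap (upTo n) h + h n             ∎
  where open ≡-Reasoning

sumMap-cong : ∀ {A : Set} (xs : List A) {h h′ : A → ℚ} → (∀ x → h x ≡ h′ x) → sumMap xs h ≡ sumMap xs h′
sumMap-cong [] eq = refl
sumMap-cong (x ∷ xs) eq = cong₂ _+_ (eq x) (sumMap-cong xs eq)

sumMap-upTo-cong : ∀ M {h h′ : ℕ → ℚ} → (∀ n → n ℕ.< M → h n ≡ h′ n) → sumMap (upTo M) h ≡ sumMap (upTo M) h′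
sumMap-upTo-cong zero eq = refl
sumMap-upTo-cong (suc M) {h} {h′} eq = begin
  sumMap (upTo (suc M)) h    ≡⟨ sumMap-upTo-suc M h ⟩
  sumMap (upTo M) h + h M    ≡⟨ cong₂ _+_ (sumMap-upTo-cong M (λ n n<M → eq n (ℕₚ.m<n⇒m<1+n n<M))) (eq M ℕₚ.≤-refl) ⟩
  sumMap (upTo M) h′ + h′ M  ≡⟨ sumMap-upTo-suc M h′ ⟨
  sumMap (upTo (suc M)) h′ ∎
  where open ≡-Reasoning

sumMap-linear : ∀ {A : Set} (xs : List A) a b (h h′ : A → ℚ) →
  sumMap xs (λ x → a * h x + b * h′ x) ≡ a * sumMap xs h + b * sumMap xs h′
sumMap-linear [] a b h h′ = solve 2 (λ a b → con 0ℚ := a :* con 0ℚ :+ b :* con 0ℚ) refl a b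
sumMap-linear (x ∷ xs) a b h h′ = trans (cong (λ z → a * h x + b * h′ x + z) (sumMap-linear xs a b h h′))
  (solve 6 (λ a b u v U V → (a :* u :+ b :* v) :+ (a :* U :+ b :* V) := a :* (u :+ U) :+ b :* (v :+ V))
    refl a b (h x) (h′ x) (sumMap xs h) (sumMap xs h′))

sumMap-upTo-1 : ∀ M → sumMap (upTo M) (λ _ → 1ℚ) ≡ ℕtoℚ M
sumMap-upTo-1 zero = refl
sumMap-upTo-1 (suc M) = begin
  sumMap (upTo (suc M)) (λ _ → 1ℚ)  ≡⟨ sumMap-upTo-suc M _ ⟩
  sumMap (upTo M) (λ _ → 1ℚ) + 1ℚ   ≡⟨ cong (_+ 1ℚ) (sumMap-upTo-1 M) ⟩
  ℕtoℚ M + 1ℚ                       ≡⟨ +-comm (ℕtoℚ M) 1ℚ ⟩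
  1ℚ + ℕtoℚ M                       ≡⟨ ℕtoℚ-suc M ⟨
  ℕtoℚ (suc M)                      ∎
  where open ≡-Reasoning

sumMap-upTo-truncate : ∀ q M (h h′ : ℕ → ℚ) → M ℕ.≤ q →
  (∀ n → n ℕ.< M → h n ≡ h′ n) → (∀ n → M ℕ.≤ n → n ℕ.< q → h n ≡ 0ℚ) →
  sumMap (upTo q) h ≡ sumMap (upTo M) h′
sumMap-upTo-truncate zero .zero h h′ z≤n _ _ = refl
sumMap-upTo-truncate (suc q) M h h′ M≤1+q eq vanish with ℕₚ.m≤n⇒m<n∨m≡n M≤1+q
... | inj₂ refl = sumMap-upTo-cong (suc q) eq
... | inj₁ (s≤s M≤q) = begin
  sumMap (upTo (suc q)) h   ≡⟨ sumMap-upTo-suc q h ⟩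
  sumMap (upTo q) h + h q   ≡⟨ cong₂ _+_ (sumMap-upTo-truncate q M h h′ M≤q eq (λ n M≤n n<q → vanish n M≤n (ℕₚ.m<n⇒m<1+n n<q)))
                                         (vanish q M≤q ℕₚ.≤-refl) ⟩
  sumMap (upTo M) h′ + 0ℚ   ≡⟨ +-identityʳ _ ⟩
  sumMap (upTo M) h′        ∎
  where open ≡-Reasoning

p≤q⇒0≤q-p : ∀ {p q} → p ≤ q → 0ℚ ≤ q - p
p≤q⇒0≤q-p {p} {q} p≤q = ≤-trans (≤-reflexive (sym (+-inverseʳ p))) (+-monoˡ-≤ (- p) p≤q)

p≤∣p∣ : ∀ p → p ≤ ∣ p ∣
p≤∣p∣ p with ≤-total 0ℚ p
... | inj₁ 0≤p = ≤-reflexive (sym (0≤p⇒∣p∣≡p 0≤p))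
... | inj₂ p≤0 = ≤-trans p≤0 (0≤∣p∣ p)

∣p*q∣≤r : ∀ p q r → ∣ p ∣ ≤ 1ℚ → ∣ q ∣ ≤ r → ∣ p * q ∣ ≤ r
∣p*q∣≤r p q r ∣p∣≤1 ∣q∣≤r = begin
  ∣ p * q ∣        ≡⟨ ∣p*q∣≡∣p∣*∣q∣ p q ⟩
  ∣ p ∣ * ∣ q ∣    ≤⟨ *-monoʳ-≤-nonNeg ∣ q ∣ {{∣-∣-nonNeg q}} ∣p∣≤1 ⟩
  1ℚ * ∣ q ∣       ≡⟨ *-identityˡ ∣ q ∣ ⟩
  ∣ q ∣            ≤⟨ ∣q∣≤r ⟩
  r                ∎
  where open ≤-Reasoning

∣a*x+b*y∣≤u+v : ∀ a b x y u v → ∣ a ∣ ≤ 1ℚ → ∣ b ∣ ≤ 1ℚ → ∣ x ∣ ≤ u → ∣ y ∣ ≤ v → ∣ a * x + b * y ∣ ≤ u + v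
∣a*x+b*y∣≤u+v a b x y u v ∣a∣≤1 ∣b∣≤1 ∣x∣≤u ∣y∣≤v =
  ≤-trans (∣p+q∣≤∣p∣+∣q∣ (a * x) (b * y)) (+-mono-≤ (∣p*q∣≤r a x u ∣a∣≤1 ∣x∣≤u) (∣p*q∣≤r b y v ∣b∣≤1 ∣y∣≤v))

∈⇒≤maxℚ : ∀ {x} xs → x ∈ xs → x ≤ maxℚ xs
∈⇒≤maxℚ (y ∷ ys) (here refl) = p≤p⊔q y (maxℚ ys)
∈⇒≤maxℚ (y ∷ ys) (there x∈ys) = ≤-trans (∈⇒≤maxℚ ys x∈ys) (p≤q⊔p y (maxℚ ys))

0≤maxℚ : ∀ xs → 0ℚ ≤ maxℚ xs
0≤maxℚ [] = ≤-refl
0≤maxℚ (x ∷ xs) = ≤-trans (0≤maxℚ xs) (p≤q⊔p x (maxℚ xs))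

𝟙 : Bool → ℚ
𝟙 b = if b then 1ℚ else 0ℚ

𝟙-∧ : ∀ a b → 𝟙 (a ∧ b) ≡ 𝟙 a * 𝟙 b
𝟙-∧ true b = sym (*-identityˡ (𝟙 b))
𝟙-∧ false b = sym (*-zeroˡ (𝟙 b))

length-filterᵇ : ∀ (p : ℕ → Bool) xs → ℕtoℚ (length (filterᵇ p xs)) ≡ sumMap xs (λ n → 𝟙 (p n))
length-filterᵇ p [] = refl
length-filterᵇ p (x ∷ xs) with p x
... | true = trans (ℕtoℚ-suc (length (filterᵇ p xs))) (cong (λ z → 1ℚ + z) (length-filterᵇ p xs))
... | false = trans (length-filterᵇ p xs) (sym (+-identityˡ _))

range : ℕ → ℕ → List ℕ
range a zero = []
range a (suc ℓ) = a ∷ range (suc a) ℓ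

length-range : ∀ a ℓ → length (range a ℓ) ≡ ℓ
length-range a zero = refl
length-range a (suc ℓ) = cong suc (length-range (suc a) ℓ)

range-mono : ∀ a {ℓ m} → ℓ ℕ.≤ m → range a ℓ ⊆ range a m
range-mono a {zero} {m} _ = minimum (range a m)
range-mono a {suc ℓ} {suc m} (s≤s ℓ≤m) = refl ∷ range-mono (suc a) ℓ≤m

applyUpTo≡range : ∀ (h : ℕ → ℕ) a n → (∀ i → h i ≡ a ℕ.+ i) → applyUpTo h n ≡ range a n
applyUpTo≡range h a zero eq = refl
applyUpTo≡range h a (suc n) eq = cong₂ _∷_ (trans (eq 0) (ℕₚ.+-identityʳ a))
  (applyUpTo≡range (λ i → h (suc i)) (suc a) n (λ i → trans (eq (suc i)) (ℕₚ.+-suc a i)))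

upTo≡range : ∀ n → upTo n ≡ range 0 n
upTo≡range n = applyUpTo≡range (λ i → i) 0 n (λ i → refl)

⊆⇒∈choose : ∀ {J ys} → J ⊆ ys → J ∈ choose (length J) ys
⊆⇒∈choose [] = here refl
⊆⇒∈choose {[]} (y ∷ʳ J⊆ys) = here refl
⊆⇒∈choose {j ∷ J} (y ∷ʳ J⊆ys) = ∈-++⁺ʳ (map (y ∷_) (choose (length J) _)) (⊆⇒∈choose J⊆ys)
⊆⇒∈choose (refl ∷ J⊆ys) = ∈-++⁺ˡ (∈-map⁺ (_ ∷_) (⊆⇒∈choose J⊆ys))

module PatternExpansion (f : ℕ → ℚ) (c s : Bool → ℚ)
  (∣c∣≤1 : ∀ b → ∣ c b ∣ ≤ 1ℚ) (∣s∣≤1 : ∀ b → ∣ s b ∣ ≤ 1ℚ) where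

  corrProd : List ℕ → ℕ → ℚ
  corrProd ds n = prodℚ (map (λ d → f (n ℕ.+ d)) ds)

  patternProd : ∀ {ℓ} → Vec Bool ℓ → ℕ → ℚ
  patternProd [] n = 1ℚ
  patternProd (b ∷ bs) n = (c b + s b * f n) * patternProd bs (suc n)

  coeffProd : ∀ {ℓ} → Vec Bool ℓ → ℚ
  coeffProd [] = 1ℚ
  coeffProd (b ∷ bs) = c b * coeffProd bs

  ∣coeffProd∣≤1 : ∀ {ℓ} (b : Vec Bool ℓ) → ∣ coeffProd b ∣ ≤ 1ℚ
  ∣coeffProd∣≤1 [] = ≤-refl
  ∣coeffProd∣≤1 (x ∷ xs) = ∣p*q∣≤r (c x) (coeffProd xs) 1ℚ (∣c∣≤1 x) (∣coeffProd∣≤1 xs)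

  -- c x p - ½ h = ½ (p - h) + p (c x - ½): each letter adds at most δ.
  ∣coeffProd-½^ℓ∣≤ℓδ : ∀ {δ} → (∀ a → ∣ c a - ½ ∣ ≤ δ) → ∀ {ℓ} (b : Vec Bool ℓ) →
    ∣ coeffProd b - powℚ ½ ℓ ∣ ≤ ℕtoℚ ℓ * δ
  ∣coeffProd-½^ℓ∣≤ℓδ {δ} near [] = ≤-reflexive (sym (*-zeroˡ δ))
  ∣coeffProd-½^ℓ∣≤ℓδ {δ} near {suc ℓ} (x ∷ xs) = begin
    ∣ c x * p - ½ * h ∣                ≡⟨ cong ∣_∣ (solve 4 (λ c p ½ h → c :* p :- ½ :* h := ½ :* (p :- h) :+ p :* (c :- ½)) refl (c x) p ½ h) ⟩
    ∣ ½ * (p - h) + p * (c x - ½) ∣    ≤⟨ ∣a*x+b*y∣≤u+v ½ p _ _ _ _ ∣½∣≤1 (∣coeffProd∣≤1 xs) (∣coeffProd-½^ℓ∣≤ℓδ near xs) (near x) ⟩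
    ℕtoℚ ℓ * δ + δ                     ≡⟨ solve 2 (λ l d → l :* d :+ d := (con 1ℚ :+ l) :* d) refl (ℕtoℚ ℓ) δ ⟩
    (1ℚ + ℕtoℚ ℓ) * δ                  ≡⟨ cong (_* δ) (ℕtoℚ-suc ℓ) ⟨
    ℕtoℚ (suc ℓ) * δ                   ∎
    where
    open ≤-Reasoning
    p = coeffProd xs
    h = powℚ ½ ℓ
    ∣½∣≤1 : ∣ ½ ∣ ≤ 1ℚ
    ∣½∣≤1 = toWitness {a? = ∣ ½ ∣ ≤? 1ℚ} tt

  corrProd-∷ʳ : ∀ K a n → corrProd (K ++ [ a ]) n ≡ corrProd K n * f (n ℕ.+ a)
  corrProd-∷ʳ K a n = begin
    prodℚ (map _ (K ++ [ a ]))               ≡⟨ cong prodℚ (map-++ _ K [ a ]) ⟩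
    prodℚ (map _ K ++ [ f (n ℕ.+ a) ])       ≡⟨ prodℚ-++ (map _ K) _ ⟩
    corrProd K n * (f (n ℕ.+ a) * 1ℚ)        ≡⟨ cong (corrProd K n *_) (*-identityʳ _) ⟩
    corrProd K n * f (n ℕ.+ a)               ∎
    where open ≡-Reasoning

  module _ (M : ℕ) where

    -- Expanding the first letter of b either keeps its mean c or moves its offset a into K.
    patternSum : ∀ {ℓ} → List ℕ → Vec Bool ℓ → ℕ → ℚ
    patternSum K b a = sumMap (upTo M) (λ n → corrProd K n * patternProd b (n ℕ.+ a))

    patternSum-[] : ∀ K a → patternSum K [] a ≡ sumMap (upTo M) (corrProd K)
    patternSum-[] K a = sumMap-cong (upTo M) (λ n → *-identityʳ (corrProd K n))

    patternSum-∷ : ∀ {ℓ} K x (xs : Vec Bool ℓ) a →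
      patternSum K (x ∷ xs) a ≡ c x * patternSum K xs (suc a) + s x * patternSum (K ++ [ a ]) xs (suc a)
    patternSum-∷ K x xs a = trans (sumMap-cong (upTo M) expand) (sumMap-linear (upTo M) (c x) (s x) _ _)
      where
      expand : ∀ n → corrProd K n * patternProd (x ∷ xs) (n ℕ.+ a) ≡
        c x * (corrProd K n * patternProd xs (n ℕ.+ suc a)) + s x * (corrProd (K ++ [ a ]) n * patternProd xs (n ℕ.+ suc a))
      expand n rewrite corrProd-∷ʳ K a n | ℕₚ.+-suc n a =
        solve 5 (λ c s F f p → F :* ((c :+ s :* f) :* p) := c :* (F :* p) :+ s :* ((F :* f) :* p))
          refl (c x) (s x) (corrProd K n) (f (n ℕ.+ a)) (patternProd xs (suc (n ℕ.+ a)))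

    ∣patternSum∣≤2^ℓB : ∀ {B ℓ} (b : Vec Bool ℓ) a K →
      (∀ J → J ⊆ range a ℓ → ∣ sumMap (upTo M) (corrProd (K ++ J)) ∣ ≤ B) →
      ∣ patternSum K b a ∣ ≤ ℕtoℚ (2 ℕ.^ ℓ) * B
    ∣patternSum∣≤2^ℓB {B} [] a K bound = begin
      ∣ patternSum K [] a ∣                      ≡⟨ cong ∣_∣ (trans (patternSum-[] K a) (cong (λ L → sumMap (upTo M) (corrProd L)) (sym (++-identityʳ K)))) ⟩
      ∣ sumMap (upTo M) (corrProd (K ++ [])) ∣   ≤⟨ bound [] [] ⟩
      B                                          ≡⟨ *-identityˡ B ⟨
      1ℚ * B                                     ∎
      where open ≤-Reasoning
    ∣patternSum∣≤2^ℓB {B} {suc ℓ} (x ∷ xs) a K bound = begin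
      ∣ patternSum K (x ∷ xs) a ∣                ≡⟨ cong ∣_∣ (patternSum-∷ K x xs a) ⟩
      ∣ c x * _ + s x * _ ∣                      ≤⟨ ∣a*x+b*y∣≤u+v (c x) (s x) _ _ _ _ (∣c∣≤1 x) (∣s∣≤1 x)
                                                      (∣patternSum∣≤2^ℓB xs (suc a) K (λ J J⊆ → bound J (a ∷ʳ J⊆)))
                                                      (∣patternSum∣≤2^ℓB xs (suc a) (K ++ [ a ]) bound-∷ʳ) ⟩
      ℕtoℚ (2 ℕ.^ ℓ) * B + ℕtoℚ (2 ℕ.^ ℓ) * B    ≡⟨ 2^ℓ*B-suc ℓ B ⟩
      ℕtoℚ (2 ℕ.^ suc ℓ) * B                     ∎
      where
      open ≤-Reasoning
      bound-∷ʳ : ∀ J → J ⊆ range (suc a) ℓ → ∣ sumMap (upTo M) (corrProd ((K ++ [ a ]) ++ J)) ∣ ≤ B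
      bound-∷ʳ J J⊆ = subst (λ L → ∣ sumMap (upTo M) (corrProd L) ∣ ≤ B) (sym (++-assoc K [ a ] J)) (bound (a ∷ J) (refl ∷ J⊆))

    -- The empty index set yields the main term; all others are correlation sums.
    patternSum-expansion : ∀ {B ℓ} → 0ℚ ≤ B → (b : Vec Bool ℓ) → ∀ a →
      (∀ J → J ⊆ range a ℓ → 0 ℕ.< length J → ∣ sumMap (upTo M) (corrProd J) ∣ ≤ B) →
      ∣ patternSum [] b a - coeffProd b * ℕtoℚ M ∣ ≤ ℕtoℚ (2 ℕ.^ ℓ) * B
    patternSum-expansion {B} 0≤B [] a bound = begin
      ∣ patternSum [] [] a - 1ℚ * ℕtoℚ M ∣   ≡⟨ cong ∣_∣ vanish ⟩
      ∣ 0ℚ ∣                                ≤⟨ 0≤B ⟩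
      B                                     ≡⟨ *-identityˡ B ⟨
      1ℚ * B                                ∎
      where
      open ≤-Reasoning
      vanish : patternSum [] [] a - 1ℚ * ℕtoℚ M ≡ 0ℚ
      vanish = trans (cong₂ _-_ (trans (patternSum-[] [] a) (sumMap-upTo-1 M)) (*-identityˡ (ℕtoℚ M))) (+-inverseʳ (ℕtoℚ M))
    patternSum-expansion {B} {suc ℓ} 0≤B (x ∷ xs) a bound = begin
      ∣ patternSum [] (x ∷ xs) a - c x * p * m ∣           ≡⟨ cong ∣_∣ regroup ⟩
      ∣ c x * (patternSum [] xs (suc a) - p * m) + s x * patternSum [ a ] xs (suc a) ∣
                                                          ≤⟨ ∣a*x+b*y∣≤u+v (c x) (s x) _ _ _ _ (∣c∣≤1 x) (∣s∣≤1 x)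
                                                               (patternSum-expansion 0≤B xs (suc a) (λ J J⊆ → bound J (a ∷ʳ J⊆)))
                                                               (∣patternSum∣≤2^ℓB xs (suc a) [ a ] (λ J J⊆ → bound (a ∷ J) (refl ∷ J⊆) (s≤s z≤n))) ⟩
      ℕtoℚ (2 ℕ.^ ℓ) * B + ℕtoℚ (2 ℕ.^ ℓ) * B             ≡⟨ 2^ℓ*B-suc ℓ B ⟩
      ℕtoℚ (2 ℕ.^ suc ℓ) * B                              ∎
      where
      open ≤-Reasoning
      p = coeffProd xs
      m = ℕtoℚ M
      regroup : patternSum [] (x ∷ xs) a - c x * p * m ≡ c x * (patternSum [] xs (suc a) - p * m) + s x * patternSum [ a ] xs (suc a)
      regroup = trans (cong (_- c x * p * m) (patternSum-∷ [] x xs a))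
        (solve 6 (λ c s X Y p m → (c :* X :+ s :* Y) :- c :* p :* m := c :* (X :- p :* m) :+ s :* Y)
          refl (c x) (s x) (patternSum [] xs (suc a)) (patternSum [ a ] xs (suc a)) p m)

∃-member : ∀ {n} (S : Subset n) → 0 ℕ.< card S → Σ (Fin n) λ i → lookup S i ≡ true
∃-member (true ∷ S) _ = zero , refl
∃-member (false ∷ S) 0<∣S∣ with ∃-member S 0<∣S∣
... | i , i∈S = suc i , i∈S

∃-nonmember : ∀ {n} (S : Subset n) → card S ℕ.< n → Σ (Fin n) λ i → lookup S i ≡ false
∃-nonmember (false ∷ S) _ = zero , refl
∃-nonmember (true ∷ S) (s≤s ∣S∣<n) with ∃-nonmember S ∣S∣<n
... | i , i∉S = suc i , i∉S

¼ : ℚ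
¼ = (+ 1) / 4

½≰¼ : ½ ≤ ¼ → ⊥
½≰¼ ½≤¼ = <-irrefl refl (<-≤-trans (toWitness {a? = ¼ <? ½} tt) ½≤¼)

module Counting (q : ℕ) .{{_ : NonZero q}} (S : Subset q) where

  α : ℚ
  α = (+ card S) / q

  0≤α : 0ℚ ≤ α
  0≤α = nonNegative⁻¹ _ {{normalize-nonNeg (card S) q}}

  α≤1 : α ≤ 1ℚ
  α≤1 = begin
    α                                 ≡⟨ n/k≡n*[1/k] (card S) q ⟩
    ℕtoℚ (card S) * ((+ 1) / q)       ≤⟨ *-monoʳ-≤-nonNeg ((+ 1) / q) {{normalize-nonNeg 1 q}} (ℕtoℚ-mono-≤ (∣p∣≤n S)) ⟩
    ℕtoℚ q * ((+ 1) / q)              ≡⟨ k*[1/k]≡1 q ⟩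
    1ℚ                                ∎
    where open ≤-Reasoning

  mean : Bool → ℚ
  mean b = if b then α else 1ℚ - α

  sign : Bool → ℚ
  sign b = if b then 1ℚ else - 1ℚ

  ∣mean∣≤1 : ∀ b → ∣ mean b ∣ ≤ 1ℚ
  ∣mean∣≤1 true = ≤-trans (≤-reflexive (0≤p⇒∣p∣≡p 0≤α)) α≤1
  ∣mean∣≤1 false = ≤-trans (≤-reflexive (0≤p⇒∣p∣≡p (p≤q⇒0≤q-p α≤1))) 1-α≤1
    where
    1-α≤1 : 1ℚ - α ≤ 1ℚ
    1-α≤1 = ≤-trans (+-monoʳ-≤ 1ℚ (neg-antimono-≤ 0≤α)) (≤-reflexive (+-identityʳ 1ℚ))

  ∣sign∣≤1 : ∀ b → ∣ sign b ∣ ≤ 1ℚ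
  ∣sign∣≤1 true = ≤-refl
  ∣sign∣≤1 false = ≤-refl

  open PatternExpansion (fR q S) mean sign ∣mean∣≤1 ∣sign∣≤1 public

  𝟙-eqB : ∀ b n → 𝟙 (eqB b (u q S n)) ≡ mean b + sign b * fR q S n
  𝟙-eqB true n with u q S n
  ... | true = solve 1 (λ a → con 1ℚ := a :+ con 1ℚ :* (con 1ℚ :- a)) refl α
  ... | false = solve 1 (λ a → con 0ℚ := a :+ con 1ℚ :* (con 0ℚ :- a)) refl α
  𝟙-eqB false n with u q S n
  ... | true = solve 1 (λ a → con 0ℚ := (con 1ℚ :- a) :+ (:- con 1ℚ) :* (con 1ℚ :- a)) refl α
  ... | false = solve 1 (λ a → con 1ℚ := (con 1ℚ :- a) :+ (:- con 1ℚ) :* (con 0ℚ :- a)) refl α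

  𝟙-matchAt : ∀ {ℓ} (b : Vec Bool ℓ) n → 𝟙 (matchAt q S b n) ≡ patternProd b n
  𝟙-matchAt [] n = refl
  𝟙-matchAt (x ∷ xs) n = trans (𝟙-∧ (eqB x (u q S n)) _) (cong₂ _*_ (𝟙-eqB x n) (𝟙-matchAt xs (suc n)))

  Npat≡patternSum : ∀ {ℓ} (b : Vec Bool ℓ) M → M ℕ.≤ q →
    (∀ n → n ℕ.< M → n ℕ.+ ℓ ℕ.≤ q) → (∀ n → M ℕ.≤ n → n ℕ.+ ℓ ℕ.≤ q → ⊥) →
    ℕtoℚ (Npat q S b) ≡ patternSum M [] b 0
  Npat≡patternSum {ℓ} b M M≤q fits overflows = begin
    ℕtoℚ (Npat q S b)                                      ≡⟨ length-filterᵇ _ (upTo q) ⟩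
    sumMap (upTo q) (λ n → 𝟙 ((n ℕ.+ ℓ ℕ.≤ᵇ q) ∧ matchAt q S b n))
                                                           ≡⟨ sumMap-upTo-truncate q M _ _ M≤q admissible inadmissible ⟩
    sumMap (upTo M) (λ n → 𝟙 (matchAt q S b n))            ≡⟨ sumMap-cong (upTo M) reindex ⟩
    patternSum M [] b 0                                    ∎
    where
    open ≡-Reasoning
    admissible : ∀ n → n ℕ.< M → 𝟙 ((n ℕ.+ ℓ ℕ.≤ᵇ q) ∧ matchAt q S b n) ≡ 𝟙 (matchAt q S b n)
    admissible n n<M with n ℕ.+ ℓ ℕ.≤ᵇ q in eq
    ... | true = refl
    ... | false = ⊥-elim (subst T eq (ℕₚ.≤⇒≤ᵇ (fits n n<M)))
    inadmissible : ∀ n → M ℕ.≤ n → n ℕ.< q → 𝟙 ((n ℕ.+ ℓ ℕ.≤ᵇ q) ∧ matchAt q S b n) ≡ 0ℚ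
    inadmissible n M≤n _ with n ℕ.+ ℓ ℕ.≤ᵇ q in eq
    ... | true = ⊥-elim (overflows n M≤n (ℕₚ.≤ᵇ⇒≤ _ _ (subst T (sym eq) tt)))
    ... | false = refl
    reindex : ∀ n → 𝟙 (matchAt q S b n) ≡ corrProd [] n * patternProd b (n ℕ.+ 0)
    reindex n = trans (𝟙-matchAt b n) (trans (cong (patternProd b) (sym (ℕₚ.+-identityʳ n))) (sym (*-identityˡ _)))

  weight≤length : ∀ {ℓ} (b : Vec Bool ℓ) → weight b ℕ.≤ ℓ
  weight≤length [] = z≤n
  weight≤length (true ∷ b) = s≤s (weight≤length b)
  weight≤length (false ∷ b) = ℕₚ.m≤n⇒m≤1+n (weight≤length b)

  coeffProd≡pow : ∀ {ℓ} (b : Vec Bool ℓ) → coeffProd b ≡ powℚ α (weight b) * powℚ (1ℚ - α) (ℓ ℕ.∸ weight b)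
  coeffProd≡pow [] = refl
  coeffProd≡pow (true ∷ b) = trans (cong (α *_) (coeffProd≡pow b)) (sym (*-assoc α _ _))
  coeffProd≡pow {suc ℓ} (false ∷ b) = begin
    (1ℚ - α) * coeffProd b                                          ≡⟨ cong ((1ℚ - α) *_) (coeffProd≡pow b) ⟩
    (1ℚ - α) * (powℚ α (weight b) * powℚ (1ℚ - α) (ℓ ℕ.∸ weight b)) ≡⟨ solve 3 (λ β x y → β :* (x :* y) := x :* (β :* y)) refl (1ℚ - α) (powℚ α (weight b)) (powℚ (1ℚ - α) (ℓ ℕ.∸ weight b)) ⟩
    powℚ α (weight b) * powℚ (1ℚ - α) (suc (ℓ ℕ.∸ weight b))        ≡⟨ cong (λ k → powℚ α (weight b) * powℚ (1ℚ - α) k) (ℕₚ.+-∸-assoc 1 (weight≤length b)) ⟨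
    powℚ α (weight b) * powℚ (1ℚ - α) (suc ℓ ℕ.∸ weight b)          ∎
    where open ≡-Reasoning

  mainTerm≡coeffProd*q : ∀ {ℓ} (b : Vec Bool ℓ) → mainTerm q S b ≡ coeffProd b * ℕtoℚ q
  mainTerm≡coeffProd*q b = cong (_* ℕtoℚ q) (sym (coeffProd≡pow b))

  0≤Cmeas : ∀ ℓ → 0ℚ ≤ Cmeas q S ℓ
  0≤Cmeas ℓ = 0≤maxℚ (map (λ j → Ck q S (suc j)) (upTo ℓ))

  Ck≤Cmeas : ∀ {j ℓ} → j ℕ.< ℓ → Ck q S (suc j) ≤ Cmeas q S ℓ
  Ck≤Cmeas j<ℓ = ∈⇒≤maxℚ _ (∈-map⁺ (λ j → Ck q S (suc j)) (∈-upTo⁺ j<ℓ))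

  ∣corrSum∣≤Cmeas : ∀ {ℓ m d ds} → m ℕ.< q → (d ∷ ds) ⊆ upTo q → length ds ℕ.< ℓ →
    ∣ sumMap (upTo (suc m)) (corrProd (d ∷ ds)) ∣ ≤ Cmeas q S ℓ
  ∣corrSum∣≤Cmeas {m = m} {d} {ds} m<q J⊆ |ds|<ℓ = ≤-trans (∈⇒≤maxℚ _ J∈) (Ck≤Cmeas |ds|<ℓ)
    where
    windows : ℕ → List ℚ
    windows m = map (corrSum q S (suc m)) (choose (length (d ∷ ds)) (upTo q))
    J∈ : corrSum q S (suc m) (d ∷ ds) ∈ concatMap windows (upTo q)
    J∈ = ∈-concatMap⁺ windows (lose (∈-upTo⁺ m<q) (∈-map⁺ (corrSum q S (suc m)) (⊆⇒∈choose J⊆)))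

  ∣fR∣≤Cmeas : ∀ {ℓ d} → 1 ℕ.≤ ℓ → d ℕ.< q → ∣ fR q S d ∣ ≤ Cmeas q S ℓ
  ∣fR∣≤Cmeas {ℓ} {d} ℓ≥1 d<q = begin
    ∣ fR q S d ∣                                  ≡⟨ cong ∣_∣ (sym (trans (+-identityʳ _) (*-identityʳ _))) ⟩
    ∣ sumMap (upTo 1) (corrProd [ d ]) ∣          ≤⟨ ∣corrSum∣≤Cmeas (ℕ.>-nonZero⁻¹ q) (from∈ (∈-upTo⁺ d<q)) ℓ≥1 ⟩
    Cmeas q S ℓ                                   ∎
    where open ≤-Reasoning

  fR-toℕ : ∀ i → fR q S (toℕ i) ≡ 𝟙 (lookup S i) - α
  fR-toℕ i = cong (λ b → 𝟙 (lookup S b) - α) (toℕ-injective (trans (toℕ-fromℕ< _) (m<n⇒m%n≡m (toℕ<n i))))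

  -- f_S takes the value 1 - α on S and -α off S, and both are correlations of order 1.
  1≤Cmeas+Cmeas : ∀ {ℓ} → 1 ℕ.≤ ℓ → 0 ℕ.< card S → card S ℕ.< q → 1ℚ ≤ Cmeas q S ℓ + Cmeas q S ℓ
  1≤Cmeas+Cmeas {ℓ} ℓ≥1 0<T T<q with ∃-member S 0<T | ∃-nonmember S T<q
  ... | i , i∈S | k , k∉S = begin
    1ℚ                                  ≡⟨ solve 1 (λ a → con 1ℚ := (con 1ℚ :- a) :+ (:- (con 0ℚ :- a))) refl α ⟩
    (1ℚ - α) + - (0ℚ - α)               ≡⟨ cong₂ (λ x y → x + - y) (fR-at i i∈S) (fR-at k k∉S) ⟨
    fR q S (toℕ i) + - fR q S (toℕ k)   ≤⟨ +-mono-≤ (p≤∣p∣ (fR q S (toℕ i))) (≤-trans (p≤∣p∣ (- fR q S (toℕ k))) (≤-reflexive (∣-p∣≡∣p∣ (fR q S (toℕ k))))) ⟩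
    ∣ fR q S (toℕ i) ∣ + ∣ fR q S (toℕ k) ∣
                                        ≤⟨ +-mono-≤ (∣fR∣≤Cmeas ℓ≥1 (toℕ<n i)) (∣fR∣≤Cmeas ℓ≥1 (toℕ<n k)) ⟩
    Cmeas q S ℓ + Cmeas q S ℓ           ∎
    where
    open ≤-Reasoning
    fR-at : ∀ j {b} → lookup S j ≡ b → fR q S (toℕ j) ≡ 𝟙 b - α
    fR-at j refl = fR-toℕ j

  ∣windowCorr∣≤Cmeas : ∀ {ℓ} → 1 ℕ.≤ ℓ → ℓ ℕ.≤ q → ∀ J → J ⊆ range 0 ℓ → 0 ℕ.< length J →
    ∣ sumMap (upTo (suc (q ℕ.∸ ℓ))) (corrProd J) ∣ ≤ Cmeas q S ℓ
  ∣windowCorr∣≤Cmeas {ℓ} ℓ≥1 ℓ≤q (d ∷ ds) J⊆ _ = ∣corrSum∣≤Cmeas (ℕₚ.∸-monoʳ-< ℓ≥1 ℓ≤q) J⊆upTo |ds|<ℓ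
    where
    J⊆upTo : (d ∷ ds) ⊆ upTo q
    J⊆upTo = ⊆-trans J⊆ (subst (range 0 ℓ ⊆_) (sym (upTo≡range q)) (range-mono 0 ℓ≤q))
    |ds|<ℓ : length ds ℕ.< ℓ
    |ds|<ℓ = ℕₚ.≤-trans (length-mono-≤ J⊆) (ℕₚ.≤-reflexive (length-range 0 ℓ))

  -- With M windows and k = q - M ≤ ℓ, the count differs from the main term by the
  -- expansion error plus coeffProd b · k, and k ≤ 2^ℓ ≤ 2^ℓ (C + C).
  count-error : ∀ {ℓ} → 1 ℕ.≤ ℓ → 0 ℕ.< card S → card S ℕ.< q → (b : Vec Bool ℓ) → ∀ M k →
    M ℕ.+ k ≡ q → k ℕ.≤ ℓ → ℕtoℚ (Npat q S b) ≡ patternSum M [] b 0 →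
    (∀ J → J ⊆ range 0 ℓ → 0 ℕ.< length J → ∣ sumMap (upTo M) (corrProd J) ∣ ≤ Cmeas q S ℓ) →
    ∣ ℕtoℚ (Npat q S b) - mainTerm q S b ∣ ≤ ℕtoℚ 3 * ℕtoℚ (2 ℕ.^ ℓ) * Cmeas q S ℓ
  count-error {ℓ} ℓ≥1 0<T T<q b M k M+k≡q k≤ℓ Npat≡ bound = begin
    ∣ ℕtoℚ (Npat q S b) - mainTerm q S b ∣          ≡⟨ cong ∣_∣ split ⟩
    ∣ 1ℚ * (Σ₀ - p * ℕtoℚ M) + (- p) * ℕtoℚ k ∣      ≤⟨ ∣a*x+b*y∣≤u+v 1ℚ (- p) _ _ _ _ ≤-refl ∣-p∣≤1
                                                         (patternSum-expansion M (0≤Cmeas ℓ) b 0 bound) ∣k∣≤ℓ ⟩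
    P * C + ℕtoℚ ℓ                                  ≤⟨ +-monoʳ-≤ (P * C) ℓ≤P*[C+C] ⟩
    P * C + P * (C + C)                             ≡⟨ solve 2 (λ P C → P :* C :+ P :* (C :+ C) := (con 1ℚ :+ con 1ℚ :+ con 1ℚ) :* P :* C) refl P C ⟩
    ℕtoℚ 3 * P * C                                  ∎
    where
    open ≤-Reasoning
    p = coeffProd b
    P = ℕtoℚ (2 ℕ.^ ℓ)
    C = Cmeas q S ℓ
    Σ₀ = patternSum M [] b 0
    split : ℕtoℚ (Npat q S b) - mainTerm q S b ≡ 1ℚ * (Σ₀ - p * ℕtoℚ M) + (- p) * ℕtoℚ k
    split = trans (cong₂ _-_ Npat≡ (trans (mainTerm≡coeffProd*q b) (cong (λ n → p * ℕtoℚ n) (sym M+k≡q))))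
      (trans (cong (λ x → Σ₀ - p * x) (ℕtoℚ-+ M k))
        (solve 4 (λ s p m k → s :- p :* (m :+ k) := con 1ℚ :* (s :- p :* m) :+ (:- p) :* k) refl Σ₀ p (ℕtoℚ M) (ℕtoℚ k)))
    ∣-p∣≤1 : ∣ - p ∣ ≤ 1ℚ
    ∣-p∣≤1 = ≤-trans (≤-reflexive (∣-p∣≡∣p∣ p)) (∣coeffProd∣≤1 b)
    ∣k∣≤ℓ : ∣ ℕtoℚ k ∣ ≤ ℕtoℚ ℓ
    ∣k∣≤ℓ = ≤-trans (≤-reflexive (0≤p⇒∣p∣≡p (0≤ℕtoℚ k))) (ℕtoℚ-mono-≤ k≤ℓ)
    ℓ≤P*[C+C] : ℕtoℚ ℓ ≤ P * (C + C)
    ℓ≤P*[C+C] = ≤-trans (ℕtoℚ-mono-≤ (ℓ≤2^ℓ ℓ))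
      (≤-trans (≤-reflexive (sym (*-identityʳ P))) (*-monoˡ-≤-nonNeg P {{nonNegative (0≤ℕtoℚ (2 ℕ.^ ℓ))}} (1≤Cmeas+Cmeas ℓ≥1 0<T T<q)))

  pattern-count-error : ∀ {ℓ} → 1 ℕ.≤ ℓ → 0 ℕ.< card S → card S ℕ.< q → (b : Vec Bool ℓ) →
    ∣ ℕtoℚ (Npat q S b) - mainTerm q S b ∣ ≤ ℕtoℚ 3 * ℕtoℚ (2 ℕ.^ ℓ) * Cmeas q S ℓ
  pattern-count-error {ℓ} ℓ≥1 0<T T<q b with ℓ ℕ.≤? q
  ... | yes ℓ≤q = count-error ℓ≥1 0<T T<q b (suc (q ℕ.∸ ℓ)) (ℓ ℕ.∸ 1) (windows+rest ℓ≥1 ℓ≤q) (ℕₚ.m∸n≤m ℓ 1)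
        (Npat≡patternSum b _ (ℕₚ.∸-monoʳ-< ℓ≥1 ℓ≤q) (λ _ → window-fits ℓ≤q) (λ _ → window-overflows ℓ≤q))
        (∣windowCorr∣≤Cmeas ℓ≥1 ℓ≤q)
  ... | no ℓ≰q = count-error ℓ≥1 0<T T<q b 0 q refl (ℕₚ.<⇒≤ (ℕₚ.≰⇒> ℓ≰q))
        (Npat≡patternSum b 0 z≤n (λ _ ()) (λ n _ n+ℓ≤q → ℓ≰q (ℕₚ.≤-trans (ℕₚ.m≤n+m ℓ n) n+ℓ≤q)))
        (λ _ _ _ → 0≤Cmeas ℓ)

  ∣mean-½∣≤δ : ∀ {δ} → ∣ α - ½ ∣ ≤ δ → ∀ b → ∣ mean b - ½ ∣ ≤ δ
  ∣mean-½∣≤δ near true = near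
  ∣mean-½∣≤δ near false = ≤-trans (≤-reflexive (trans (cong ∣_∣ reflect) (∣-p∣≡∣p∣ (α - ½)))) near
    where
    reflect : 1ℚ - α - ½ ≡ - (α - ½)
    reflect = solve 1 (λ a → con 1ℚ :- a :- con ½ := :- (a :- con ½)) refl α

  0<card-if-near-½ : ∀ n → ∣ (+ n) / q - ½ ∣ ≤ ¼ → 0 ℕ.< n
  0<card-if-near-½ zero near = ⊥-elim (½≰¼ (subst (λ x → ∣ x - ½ ∣ ≤ ¼) (0/n≡0 q) near))
  0<card-if-near-½ (suc n) _ = s≤s z≤n

  card<q-if-near-½ : ∣ α - ½ ∣ ≤ ¼ → card S ℕ.< q
  card<q-if-near-½ near = ℕₚ.≤∧≢⇒< (∣p∣≤n S) full-excluded
    where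
    full-excluded : card S ≢ q
    full-excluded T≡q = ½≰¼ (subst (λ x → ∣ x - ½ ∣ ≤ ¼) α≡1 near)
      where
      α≡1 : α ≡ 1ℚ
      α≡1 = trans (cong (λ t → (+ t) / q) T≡q) (trans (n/k≡n*[1/k] q q) (k*[1/k]≡1 q))

  frequency-split : ∀ {ℓ} (b : Vec Bool ℓ) → (+ Npat q S b) / q - powℚ ½ ℓ ≡
    (+ 1) / q * (ℕtoℚ (Npat q S b) - mainTerm q S b) + (coeffProd b - powℚ ½ ℓ)
  frequency-split {ℓ} b = begin
    (+ Npat q S b) / q - h                  ≡⟨ cong (_- h) (n/k≡n*[1/k] (Npat q S b) q) ⟩
    N * r - h                               ≡⟨ solve 5 (λ N r p Q h → N :* r :- h := r :* (N :- p :* Q) :+ (p :* (Q :* r) :- h)) refl N r p Q h ⟩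
    r * (N - p * Q) + (p * (Q * r) - h)     ≡⟨ cong₂ (λ x y → r * (N - x) + (p * y - h)) (sym (mainTerm≡coeffProd*q b)) (k*[1/k]≡1 q) ⟩
    r * (N - mainTerm q S b) + (p * 1ℚ - h) ≡⟨ cong (λ x → r * (N - mainTerm q S b) + (x - h)) (*-identityʳ p) ⟩
    r * (N - mainTerm q S b) + (p - h)      ∎
    where
    open ≡-Reasoning
    N = ℕtoℚ (Npat q S b)
    r = (+ 1) / q
    p = coeffProd b
    Q = ℕtoℚ q
    h = powℚ ½ ℓ

  pattern-frequency-error : ∀ {ℓ δ} → 1 ℕ.≤ ℓ → δ ≤ ¼ → ∣ α - ½ ∣ ≤ δ → Cmeas q S ℓ ≤ δ * ℕtoℚ q →
    (b : Vec Bool ℓ) → ∣ (+ Npat q S b) / q - powℚ ½ ℓ ∣ ≤ ℕtoℚ (3 ℕ.* 2 ℕ.^ ℓ ℕ.+ ℓ) * δ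
  pattern-frequency-error {ℓ} {δ} ℓ≥1 δ≤¼ near C≤δq b = begin
    ∣ (+ Npat q S b) / q - powℚ ½ ℓ ∣     ≡⟨ cong ∣_∣ (frequency-split b) ⟩
    ∣ r * D + (coeffProd b - powℚ ½ ℓ) ∣  ≤⟨ ∣p+q∣≤∣p∣+∣q∣ (r * D) _ ⟩
    ∣ r * D ∣ + ∣ coeffProd b - powℚ ½ ℓ ∣ ≤⟨ +-mono-≤ ∣r*D∣≤3Pδ (∣coeffProd-½^ℓ∣≤ℓδ (∣mean-½∣≤δ near) b) ⟩
    ℕtoℚ 3 * P * δ + ℕtoℚ ℓ * δ           ≡⟨ *-distribʳ-+ δ (ℕtoℚ 3 * P) (ℕtoℚ ℓ) ⟨
    (ℕtoℚ 3 * P + ℕtoℚ ℓ) * δ             ≡⟨ cong (_* δ) (trans (ℕtoℚ-+ (3 ℕ.* 2 ℕ.^ ℓ) ℓ) (cong (_+ ℕtoℚ ℓ) (ℕtoℚ-* 3 (2 ℕ.^ ℓ)))) ⟨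
    ℕtoℚ (3 ℕ.* 2 ℕ.^ ℓ ℕ.+ ℓ) * δ         ∎
    where
    open ≤-Reasoning
    r = (+ 1) / q
    D = ℕtoℚ (Npat q S b) - mainTerm q S b
    P = ℕtoℚ (2 ℕ.^ ℓ)
    near-¼ = ≤-trans near δ≤¼
    0≤r : 0ℚ ≤ r
    0≤r = nonNegative⁻¹ _ {{normalize-nonNeg 1 q}}
    0≤3P : 0ℚ ≤ ℕtoℚ 3 * P
    0≤3P = ≤-trans (0≤ℕtoℚ (3 ℕ.* 2 ℕ.^ ℓ)) (≤-reflexive (ℕtoℚ-* 3 (2 ℕ.^ ℓ)))
    ∣r*D∣≤3Pδ : ∣ r * D ∣ ≤ ℕtoℚ 3 * P * δ
    ∣r*D∣≤3Pδ = begin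
      ∣ r * D ∣                          ≡⟨ trans (∣p*q∣≡∣p∣*∣q∣ r D) (cong (_* ∣ D ∣) (0≤p⇒∣p∣≡p 0≤r)) ⟩
      r * ∣ D ∣                          ≤⟨ *-monoˡ-≤-nonNeg r {{nonNegative 0≤r}}
                                              (pattern-count-error ℓ≥1 (0<card-if-near-½ (card S) near-¼) (card<q-if-near-½ near-¼) b) ⟩
      r * (ℕtoℚ 3 * P * Cmeas q S ℓ)      ≤⟨ *-monoˡ-≤-nonNeg r {{nonNegative 0≤r}} (*-monoˡ-≤-nonNeg (ℕtoℚ 3 * P) {{nonNegative 0≤3P}} C≤δq) ⟩
      r * (ℕtoℚ 3 * P * (δ * ℕtoℚ q))     ≡⟨ solve 4 (λ r c d Q → r :* (c :* (d :* Q)) := c :* d :* (Q :* r)) refl r (ℕtoℚ 3 * P) δ (ℕtoℚ q) ⟩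
      ℕtoℚ 3 * P * δ * (ℕtoℚ q * r)       ≡⟨ trans (cong (ℕtoℚ 3 * P * δ *_) (k*[1/k]≡1 q)) (*-identityʳ _) ⟩
      ℕtoℚ 3 * P * δ                      ∎

small-tolerance : ∀ K .{{_ : NonZero K}} ε → 0ℚ < ε → Σ ℚ λ δ → 0ℚ < δ × δ ≤ ¼ × ℕtoℚ K * δ ≤ ε
small-tolerance K ε 0<ε = m * r , 0<δ , δ≤¼ , Kδ≤ε
  where
  m = ε ⊓ ¼
  r = (+ 1) / K
  0<m : 0ℚ < m
  0<m with ⊓-sel ε ¼
  ... | inj₁ m≡ε = subst (0ℚ <_) (sym m≡ε) 0<ε
  ... | inj₂ m≡¼ = subst (0ℚ <_) (sym m≡¼) (toWitness {a? = 0ℚ <? ¼} tt)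
  0<δ : 0ℚ < m * r
  0<δ = positive⁻¹ _ {{pos*pos⇒pos m {{positive 0<m}} r {{normalize-pos 1 K}}}}
  r≤1 : r ≤ 1ℚ
  r≤1 = begin
    r               ≡⟨ *-identityˡ r ⟨
    1ℚ * r          ≤⟨ *-monoʳ-≤-nonNeg r {{normalize-nonNeg 1 K}} (ℕtoℚ-mono-≤ (ℕ.>-nonZero⁻¹ K)) ⟩
    ℕtoℚ K * r      ≡⟨ k*[1/k]≡1 K ⟩
    1ℚ              ∎
    where open ≤-Reasoning
  δ≤¼ : m * r ≤ ¼
  δ≤¼ = ≤-trans (*-monoˡ-≤-nonNeg m {{nonNegative (<⇒≤ 0<m)}} r≤1) (≤-trans (≤-reflexive (*-identityʳ m)) (p⊓q≤q ε ¼))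
  Kδ≤ε : ℕtoℚ K * (m * r) ≤ ε
  Kδ≤ε = begin
    ℕtoℚ K * (m * r)   ≡⟨ solve 3 (λ k m r → k :* (m :* r) := m :* (k :* r)) refl (ℕtoℚ K) m r ⟩
    m * (ℕtoℚ K * r)   ≡⟨ trans (cong (m *_) (k*[1/k]≡1 K)) (*-identityʳ m) ⟩
    m                  ≤⟨ p⊓q≤p ε ¼ ⟩
    ε                  ∎
    where open ≤-Reasoning

theorem5 :
  (Σ ℚ λ c → 0ℚ < c ×
    ((q : ℕ) .{{_ : NonZero q}} (S : Subset q) (ℓ : ℕ) → ℓ ≥ 1 →
      0 ℕ.< card S → card S ℕ.< q →
      (b : Vec Bool ℓ) →
      ∣ ℕtoℚ (Npat q S b) - mainTerm q S b ∣ ≤ c * ℕtoℚ (2 ℕ.^ ℓ) * Cmeas q S ℓ))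
  ×
  ((ℓ : ℕ) → ℓ ≥ 1 → (ε : ℚ) → 0ℚ < ε →
    Σ ℚ λ δ → 0ℚ < δ × Σ ℕ λ Q →
      (q : ℕ) .{{_ : NonZero q}} → q ≥ Q → (S : Subset q) →
      ∣ (+ card S) / q - ½ ∣ ≤ δ →
      Cmeas q S ℓ ≤ δ * ℕtoℚ q →
      (b : Vec Bool ℓ) →
      ∣ (+ Npat q S b) / q - powℚ ½ ℓ ∣ ≤ ε)
-- The error bound does not depend on q, so Q = 0 suffices.
theorem5 =
  (ℕtoℚ 3 , toWitness {a? = 0ℚ <? ℕtoℚ 3} tt , λ q S ℓ ℓ≥1 → Counting.pattern-count-error q S ℓ≥1) ,
  λ ℓ ℓ≥1 ε 0<ε →
    let instance
          K≢0 : NonZero (3 ℕ.* 2 ℕ.^ ℓ ℕ.+ ℓ)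
          K≢0 = ℕ.>-nonZero (ℕₚ.≤-trans ℓ≥1 (ℕₚ.m≤n+m ℓ (3 ℕ.* 2 ℕ.^ ℓ)))
        (δ , 0<δ , δ≤¼ , Kδ≤ε) = small-tolerance (3 ℕ.* 2 ℕ.^ ℓ ℕ.+ ℓ) ε 0<ε
    in δ , 0<δ , 0 , λ q _ S near C≤δq b →
         ≤-trans (Counting.pattern-frequency-error q S ℓ≥1 δ≤¼ near C≤δq b) Kδ≤ε
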